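{- Let $\mathfrak M$ be an $\mathsf{MSO}$-Henkin structure or an $\mathsf{FO(LFP^1)}$-Henkin structure and let $A\in\mathbb A_{\mathfrak M}$ be a parametrically definable set. Let $\mathfrak M\upharpoonright A$ have domain $A$, the relations induced from $\mathfrak M$, and admissible sets $\{X\cap A: X\in\mathbb A_{\mathfrak M}\}$, and let $(\mathfrak M\upharpoonright A)'$ have domain $A$, the induced relations, and admissible sets $\{X\subseteq A: X\in\mathbb A_{\mathfrak M}\}$. Then $\mathfrak M\upharpoonright A$ and $(\mathfrak M\upharpoonright A)'$ are one and the same structure, i.e. $\{X\cap A:X\in\mathbb A_{\mathfrak M}\}=\{X\subseteq A:X\in\mathbb A_{\mathfrak M}\}$.
   Context: Vocabularies are purely relational. A frame is a relational structure $\mathfrak M$ together with a set $\mathbb A_{\mathfrak M}\subseteq\wp(dom(\mathfrak M))$ of admissible subsets; set variables are assigned admissible sets and set quantifiers/fixed-point operators range over $\mathbb A_{\mathfrak M}$ (Henkin semantics: $\exists X\varphi$ holds iff some $A\in\mathbb A_{\mathfrak M}$ witnesses it; $[LFP_{Xx}\varphi]y$ holds under $g$ iff $g(y)\in A$ for every $A\in\mathbb A_{\mathfrak M}$ such that every $a$ with $\mathfrak M,g[a/x,A/X]\models\varphi$ lies in $A$). $\mathsf{MSO}$ is first-order logic with set variables and quantifiers $\exists X$; $\mathsf{FO(LFP^1)}$ is first-order logic with set variables and formulas $[LFP_{Xx}\varphi]y$ ($\varphi$ positive in $X$). For $\Lambda$ one of these logics, a $\Lambda$-Henkin structure is a frame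 such that for every $\Lambda$-formula $\varphi$ and assignment $g$, $\{a:\mathfrak M,g[a/x]\models\varphi\}\in\mathbb A_{\mathfrak M}$; sets of this form are called parametrically definable. -}

module Defs where

open import Data.Nat using (ℕ; _≟_)
open import Data.Fin using (Fin)
open import Data.Bool using (Bool; true; false; not)
open import Data.Product using (Σ; ∃; ∃-syntax; _×_; _,_; proj₁)
open import Data.Sum using (_⊎_)
open import Data.Empty using (⊥)
open import Function using (_∘_)
open import Relation.Nullary using (¬_; yes; no)
open import Relation.Binary.PropositionalEquality using (_≡_; _≢_)

record Vocab : Set₁ where
  field
    Sym   : Set
    arity : Sym → ℕ
open Vocab public

-- The admissible sets are given as an indexed
-- family  Adm : Idx → Dom → Set ;  the set of admissible sets is
-- { Adm i : i ∈ Idx }  (subsets compared extensionally).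

record Frame (τ : Vocab) : Set₁ where
  field
    Dom : Set
    Rel : (R : Sym τ) → (Fin (arity τ R) → Dom) → Set
    Idx : Set
    Adm : Idx → Dom → Set
open Frame public

_≐_ : {U : Set} → (U → Set) → (U → Set) → Set
P ≐ Q = ∀ u → (P u → Q u) × (Q u → P u)

_⊆_ : {U : Set} → (U → Set) → (U → Set) → Set
P ⊆ Q = ∀ u → P u → Q u

FVar : Set
FVar = ℕ

SVar : Set
SVar = ℕ

data Formula (τ : Vocab) : Set where
  rel   : (R : Sym τ) → (Fin (arity τ R) → FVar) → Formula τ
  eqv   : FVar → FVar → Formula τ
  mem   : FVar → SVar → Formula τ
  neg   : Formula τ → Formula τ
  and   : Formula τ → Formula τ → Formula τ
  or    : Formula τ → Formula τ → Formula τ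
  exFO  : FVar → Formula τ → Formula τ
  allFO : FVar → Formula τ → Formula τ
  exSO  : SVar → Formula τ → Formula τ
  allSO : SVar → Formula τ → Formula τ
  lfp   : SVar → FVar → Formula τ → FVar → Formula τ -- [LFP_{Xx} φ] y

-- Polarity of occurrences of a set variable (true = positive)
data PolIn {τ : Vocab} (X : SVar) : Bool → Formula τ → Set where
  rel     : ∀ {p R xs} → PolIn X p (rel R xs)
  eqv     : ∀ {p x y} → PolIn X p (eqv x y)
  memPos  : ∀ {x Y} → PolIn X true (mem x Y)
  memOther : ∀ {p x Y} → Y ≢ X → PolIn X p (mem x Y)
  neg     : ∀ {p φ} → PolIn X (not p) φ → PolIn X p (neg φ)
  and     : ∀ {p φ ψ} → PolIn X p φ → PolIn X p ψ → PolIn X p (and φ ψ)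
  or      : ∀ {p φ ψ} → PolIn X p φ → PolIn X p ψ → PolIn X p (or φ ψ)
  exFO    : ∀ {p x φ} → PolIn X p φ → PolIn X p (exFO x φ)
  allFO   : ∀ {p x φ} → PolIn X p φ → PolIn X p (allFO x φ)
  exSObound  : ∀ {p φ} → PolIn X p (exSO X φ)
  exSO    : ∀ {p Y φ} → Y ≢ X → PolIn X p φ → PolIn X p (exSO Y φ)
  allSObound : ∀ {p φ} → PolIn X p (allSO X φ)
  allSO   : ∀ {p Y φ} → Y ≢ X → PolIn X p φ → PolIn X p (allSO Y φ)
  lfpBound : ∀ {p x φ y} → PolIn X p (lfp X x φ y)
  lfp     : ∀ {p Y x φ y} → Y ≢ X → PolIn X p φ → PolIn X p (lfp Y x φ y)

Positive : {τ : Vocab} → SVar → Formula τ → Set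
Positive X φ = PolIn X true φ

data Logic : Set where
  MSO FOLFP1 : Logic

data WF {τ : Vocab} : Logic → Formula τ → Set where
  rel   : ∀ {L R xs} → WF L (rel R xs)
  eqv   : ∀ {L x y} → WF L (eqv x y)
  mem   : ∀ {L x X} → WF L (mem x X)
  neg   : ∀ {L φ} → WF L φ → WF L (neg φ)
  and   : ∀ {L φ ψ} → WF L φ → WF L ψ → WF L (and φ ψ)
  or    : ∀ {L φ ψ} → WF L φ → WF L ψ → WF L (or φ ψ)
  exFO  : ∀ {L x φ} → WF L φ → WF L (exFO x φ)
  allFO : ∀ {L x φ} → WF L φ → WF L (allFO x φ)
  exSO  : ∀ {X φ} → WF MSO φ → WF MSO (exSO X φ)
  allSO : ∀ {X φ} → WF MSO φ → WF MSO (allSO X φ)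
  lfp   : ∀ {X x φ y} → WF FOLFP1 φ → Positive X φ → WF FOLFP1 (lfp X x φ y)

record Assignment {τ : Vocab} (M : Frame τ) : Set where
  constructor ⟨_,_⟩
  field
    fo : FVar → Dom M
    so : SVar → Idx M
open Assignment public

_[_/ₓ_] : {τ : Vocab} {M : Frame τ} → Assignment M → Dom M → FVar → Assignment M
_[_/ₓ_] g a x = ⟨ (λ z → case (z ≟ x)) , so g ⟩
  where
  case : ∀ {z} → Relation.Nullary.Dec (z ≡ x) → _
  case {z} (yes _) = a
  case {z} (no _)  = fo g z

_[_/ₛ_] : {τ : Vocab} {M : Frame τ} → Assignment M → Idx M → SVar → Assignment M
_[_/ₛ_] g i X = ⟨ fo g , (λ Z → case (Z ≟ X)) ⟩
  where
  case : ∀ {Z} → Relation.Nullary.Dec (Z ≡ X) → _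
  case {Z} (yes _) = i
  case {Z} (no _)  = so g Z

Sat : {τ : Vocab} (M : Frame τ) → Formula τ → Assignment M → Set
Sat M (rel R xs) g = Rel M R (fo g ∘ xs)
Sat M (eqv x y) g = fo g x ≡ fo g y
Sat M (mem x X) g = Adm M (so g X) (fo g x)
Sat M (neg φ) g = ¬ Sat M φ g
Sat M (and φ ψ) g = Sat M φ g × Sat M ψ g
Sat M (or φ ψ) g = Sat M φ g ⊎ Sat M ψ g
Sat M (exFO x φ) g = Σ (Dom M) λ a → Sat M φ (g [ a /ₓ x ])
Sat M (allFO x φ) g = (a : Dom M) → Sat M φ (g [ a /ₓ x ])
Sat M (exSO X φ) g = Σ (Idx M) λ i → Sat M φ (g [ i /ₛ X ])
Sat M (allSO X φ) g = (i : Idx M) → Sat M φ (g [ i /ₛ X ])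
Sat M (lfp X x φ y) g =
  (i : Idx M) →
  ((a : Dom M) → Sat M φ ((g [ a /ₓ x ]) [ i /ₛ X ]) → Adm M i a) →
  Adm M i (fo g y)

DefSet : {τ : Vocab} (M : Frame τ) → Formula τ → FVar → Assignment M → Dom M → Set
DefSet M φ x g a = Sat M φ (g [ a /ₓ x ])

ParDef : {τ : Vocab} → Logic → (M : Frame τ) → (Dom M → Set) → Set
ParDef L M A =
  Σ (Formula _) λ φ → WF L φ × Σ FVar λ x → Σ (Assignment M) λ g → A ≐ DefSet M φ x g

Henkin : {τ : Vocab} → Logic → Frame τ → Set
Henkin L M =
  (φ : Formula _) → WF L φ → (x : FVar) → (g : Assignment M) →
  Σ (Idx M) λ i → Adm M i ≐ DefSet M φ x g

-- 𝔐 ↾ A : admissible sets { X ∩ A : X ∈ 𝔸 }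
restrict : {τ : Vocab} (M : Frame τ) → Idx M → Frame τ
restrict M i = record
  { Dom = Σ (Dom M) (Adm M i)
  ; Rel = λ R t → Rel M R (proj₁ ∘ t)
  ; Idx = Idx M
  ; Adm = λ j p → Adm M j (proj₁ p)
  }

-- (𝔐 ↾ A)' : admissible sets { X ⊆ A : X ∈ 𝔸 }
restrict' : {τ : Vocab} (M : Frame τ) → Idx M → Frame τ
restrict' M i = record
  { Dom = Σ (Dom M) (Adm M i)
  ; Rel = λ R t → Rel M R (proj₁ ∘ t)
  ; Idx = Σ (Idx M) (λ j → Adm M j ⊆ Adm M i)
  ; Adm = λ j p → Adm M (proj₁ j) (proj₁ p)
  }

SameSets : {U I J : Set} → (I → U → Set) → (J → U → Set) → Set
SameSets {I = I} {J} S T =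
  ((i : I) → Σ J λ j → S i ≐ T j) × ((j : J) → Σ I λ i → T j ≐ S i)

-- Every admissible subset of A is trivially of the form X ∩ A.  Conversely, X ∩ A is
-- itself admissible as soon as the admissible sets are closed under intersection, and
-- in a Henkin structure for either logic they are: X ∩ A is defined by the
-- quantifier-free formula x ∈ X ∧ x ∈ A with set parameters X and A.
module Submission where

open import Defs
open import Data.Product using (_×_; _,_; proj₁; proj₂; Σ)
open import Function using (id)
open import Relation.Binary.PropositionalEquality using (_≡_; refl)

∩-Closed : {τ : Vocab} → Frame τ → Set
∩-Closed M = (i j : Idx M) → Σ (Idx M) λ k → Adm M k ≐ (λ a → Adm M i a × Adm M j a)

Henkin⇒∩-Closed : {τ : Vocab} (L : Logic) (M : Frame τ) →
                  Henkin L M → Assignment M → ∩-Closed M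
Henkin⇒∩-Closed L M henkin g i j =
  henkin (and (mem 0 1) (mem 0 2)) (and mem mem) 0 ((g [ i /ₛ 1 ]) [ j /ₛ 2 ])

restrict⊆restrict' : {τ : Vocab} (M : Frame τ) (A : Idx M) → ∩-Closed M →
                     (j : Idx M) → Σ (Idx (restrict' M A)) λ k →
                     Adm (restrict M A) j ≐ Adm (restrict' M A) k
restrict⊆restrict' M A closed j = (k , k⊆A) , j∩A≐k
  where
  k : Idx M
  k = proj₁ (closed j A)

  k≐j∩A : Adm M k ≐ (λ a → Adm M j a × Adm M A a)
  k≐j∩A = proj₂ (closed j A)

  k⊆A : Adm M k ⊆ Adm M A
  k⊆A a a∈k = proj₂ (proj₁ (k≐j∩A a) a∈k)

  j∩A≐k : Adm (restrict M A) j ≐ Adm (restrict' M A) (k , k⊆A)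
  j∩A≐k (a , a∈A) = (λ a∈j → proj₂ (k≐j∩A a) (a∈j , a∈A))
                  , (λ a∈k → proj₁ (proj₁ (k≐j∩A a) a∈k))

restrict'⊆restrict : {τ : Vocab} (M : Frame τ) (A : Idx M) →
                     (k : Idx (restrict' M A)) → Σ (Idx M) λ j →
                     Adm (restrict' M A) k ≐ Adm (restrict M A) j
restrict'⊆restrict M A (j , _) = j , λ _ → id , id

proposition5p2 : {τ : Vocab} (L : Logic) (M : Frame τ) → Henkin L M →
    (A : Idx M) → ParDef L M (Adm M A) →
    (Dom (restrict M A) ≡ Dom (restrict' M A)) ×
    SameSets {U = Dom (restrict M A)} (Adm (restrict M A)) (Adm (restrict' M A))
proposition5p2 L M henkin A (_ , _ , _ , g , _) =
  refl , restrict⊆restrict' M A closed , restrict'⊆restrict M A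
  where
  -- Definability of A is only needed for the first-order assignment it carries:
  -- the domain may be empty, and the Henkin condition quantifies over assignments.
  closed : ∩-Closed M
  closed = Henkin⇒∩-Closed L M henkin g
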